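{- If $\mathbf G$ is a coherent canonical system in $\mathcal L$, then $\langle\mathcal{L},\vdash_{\mathbf G}\rangle$ is an extended logic, i.e. $\vdash_{\mathbf G}$ is an extended Tarskian consequence relation for $\mathcal L$ which is structural, finitary and consistent.
   Context: $\mathcal{L}$ is a propositional language with atoms $p_1,p_2,\ldots$ and set of formulas $\mathcal{F}$. A sequent is $\Gamma\Rightarrow E$ with $\Gamma$ a finite set of formulas and $E$ a set of formulas with at most one element. A clause is a sequent of atoms. An $\mathcal{L}$-substitution is a map $\sigma:\mathcal{F}\to\mathcal{F}$ commuting with all connectives, extended pointwise to sets ($\sigma(\emptyset)=\emptyset$). A canonical right-introduction rule for an $n$-ary connective $\diamond$ is $\{\Pi_i\Rightarrow E_i\}_{1\le i\le m}/\ \Rightarrow\diamond(p_1,\dots,p_n)$ with $m\ge0$ and $\Pi_i\cup E_i\subseteq\{p_1,\dots,p_n\}$; an application infers $\Gamma\Rightarrow\sigma(\diamond(p_1,\dots,p_n))$ from $\Gamma,\sigma(\Pi_i)\Rightarrow\sigma(E_i)$ ($1\le i\le m$), for any finite $\Gamma$ and substitution $\sigma$. A canonical left-introduction rule is $\langle\{\Pi_i\Rightarrow E_i\}_{1\le i\le m},\{\Sigma_j\Rightarrow\}_{1\le j\le k}\rangle/\ \diamond(p_1,\dots,p_n)\Rightarrow$ with all atoms among $p_1,\dots,p_n$; an application infers $\Gamma,\sigma(\diamond(p_1,\dots,p_n))\Rightarrow E$ from $\Gamma,\sigma(\Pi_i)\Rightarrow\sigma(E_i)$ and $\Gamma,\sigma(\Sigma_j)\Rightarrow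 E$, for any sequent $\Gamma\Rightarrow E$ and substitution $\sigma$. A canonical system has axioms $\varphi\Rightarrow\varphi$, weakening (from $\Gamma\Rightarrow E$ infer $\Gamma,\Delta\Rightarrow E$; from $\Gamma\Rightarrow$ infer $\Gamma\Rightarrow\psi$), cut (from $\Gamma\Rightarrow\varphi$ and $\Delta,\varphi\Rightarrow E$ infer $\Gamma,\Delta\Rightarrow E$), and a set of canonical right- and left-introduction rules. $\mathcal{T}\vdash_{\mathbf G}E$ iff $\Gamma\Rightarrow E$ is derivable in $\mathbf G$ for some finite $\Gamma\subseteq\mathcal T$. A classical assignment $u$ satisfies a clause $\Pi\Rightarrow E$ iff $u(p)=f$ for some $p\in\Pi$ or $E=\{q\}$ with $u(q)=t$; $\mathbf G$ is coherent iff for every connective $\diamond$, whenever $\mathbf G$ contains a left rule $\langle S_1,S_2\rangle/\diamond(p_1,\dots,p_n)\Rightarrow$ and a right rule $S_3/\Rightarrow\diamond(p_1,\dots,p_n)$, no assignment satisfies all clauses of $S_1\cup S_2\cup S_3$. An extended Tarskian consequence relation for $\mathcal L$ is a relation $\vdash$ between sets of formulas and sets of formulas with at most one element such that: if $\varphi\in\mathcal{T}$ then $\mathcal{T}\vdash\{\varphi\}$; if $\mathcal{T}\vdash E$, $\mathcal{T}\subseteq\mathcal{T}'$, $E\subseteq E'$ then $\mathcal{T}'\vdash E'$; if $\mathcal{T}\vdash\{\psi\}$ and $\mathcal{T}\cup\{\psi\}\vdash E$ then $\mathcal{T}\vdash E$. It is structural iff $\mathcal{T}\vdash E$ implies $\sigma(\mathcal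 T)\vdash\sigma(E)$ for all substitutions $\sigma$; finitary iff $\mathcal{T}\vdash E$ implies $\Gamma\vdash E$ for some finite $\Gamma\subseteq\mathcal{T}$; consistent iff $\{p_1\}\not\vdash\{p_2\}$. -}

module Defs where

open import Data.Nat using (ℕ)
open import Data.Fin using (Fin; toℕ)
open import Data.Bool using (Bool; true; false)
open import Data.Vec using (Vec; []; _∷_; tabulate)
open import Data.List using (List; []; _∷_; _++_; map)
open import Data.List.Membership.Propositional using (_∈_)
open import Data.Maybe using (Maybe; just; nothing) renaming (map to mapMaybe)
open import Data.Product using (Σ; ∃; _×_; _,_)
open import Data.Sum using (_⊎_)
open import Relation.Nullary using (¬_)
open import Relation.Binary.PropositionalEquality using (_≡_)

-- Propositional languages: atoms p₁, p₂, … (p_{k+1} is  atom k) and an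
-- arbitrary set of connectives, each with an arity.

record Lang : Set₁ where
  field
    Conn  : Set
    arity : Conn → ℕ

module _ {L : Lang} where
  open Lang L

  data Form : Set where
    atom : ℕ → Form
    app  : (c : Conn) → Vec Form (arity c) → Form

module _ {L : Lang} where
  open Lang L

  Subst : Set
  Subst = ℕ → Form {L}

  mutual
    sub : Subst → Form {L} → Form {L}
    sub σ (atom k)   = σ k
    sub σ (app c φs) = app c (subV σ φs)

    subV : ∀ {n} → Subst → Vec (Form {L}) n → Vec (Form {L}) n
    subV σ []       = []
    subV σ (φ ∷ φs) = sub σ φ ∷ subV σ φs

  -- σ(E) for a set E with at most one element (σ(∅) = ∅)
  subE : Subst → Maybe (Form {L}) → Maybe (Form {L})
  subE σ = mapMaybe (sub σ)

-- Clauses over the atoms p₁ … pₙ (atom i : Fin n stands for p_{i+1}).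

pa : ∀ {L : Lang} {n} → Fin n → Form {L}
pa i = atom (toℕ i)

-- a clause Π ⇒ E  (E has at most one element)
Clause : ℕ → Set
Clause n = List (Fin n) × Maybe (Fin n)

-- premises of a canonical right rule  {Πᵢ ⇒ Eᵢ} / ⇒ ⋄(p₁,…,pₙ)
RightRule : ℕ → Set
RightRule n = List (Clause n)

-- premises ⟨{Πᵢ ⇒ Eᵢ}, {Σⱼ ⇒}⟩ of a canonical left rule
record LeftRule (n : ℕ) : Set where
  constructor ⟨_,_⟩
  field
    S₁ : List (Clause n)
    S₂ : List (List (Fin n))

generic : ∀ {L : Lang} (c : Lang.Conn L) → Form {L}
generic {L} c = app c (tabulate pa)

record System (L : Lang) : Set₁ where
  open Lang L
  field
    Right : (c : Conn) → RightRule (arity c) → Set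
    Left  : (c : Conn) → LeftRule (arity c) → Set

module _ {L : Lang} (G : System L) where
  open Lang L
  open System G

  -- Sequents Γ ⇒ E with Γ a finite set (represented by a list; the
  -- weakening rule below closes derivability under any list having a
  -- superset of the elements, so only the underlying set matters).
  data _⇒_ : List (Form {L}) → Maybe (Form {L}) → Set where
    axiom  : (φ : Form) → (φ ∷ []) ⇒ just φ
    weakL  : ∀ {Γ Γ' E} → Γ ⇒ E → (∀ x → x ∈ Γ → x ∈ Γ') → Γ' ⇒ E
    weakR  : ∀ {Γ} ψ → Γ ⇒ nothing → Γ ⇒ just ψ
    cut    : ∀ {Γ Δ E} φ → Γ ⇒ just φ → (φ ∷ Δ) ⇒ E → (Γ ++ Δ) ⇒ E
    right  : ∀ {Γ} (c : Conn) (r : RightRule (arity c)) → Right c r →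
             (σ : Subst) →
             (∀ Π E → (Π , E) ∈ r →
                (Γ ++ map (λ i → sub σ (pa i)) Π)
                  ⇒ mapMaybe (λ i → sub σ (pa i)) E) →
             Γ ⇒ just (sub σ (generic c))
    left   : ∀ {Γ E} (c : Conn) (r : LeftRule (arity c)) → Left c r →
             (σ : Subst) →
             (∀ Π E' → (Π , E') ∈ LeftRule.S₁ r →
                (Γ ++ map (λ i → sub σ (pa i)) Π)
                  ⇒ mapMaybe (λ i → sub σ (pa i)) E') →
             (∀ Σ' → Σ' ∈ LeftRule.S₂ r →
                (Γ ++ map (λ i → sub σ (pa i)) Σ') ⇒ E) →
             (sub σ (generic c) ∷ Γ) ⇒ E

  _⊢G_ : (Form {L} → Set) → Maybe (Form {L}) → Set
  T ⊢G E = Σ (List (Form {L})) λ Γ → (∀ x → x ∈ Γ → T x) × (Γ ⇒ E)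

Assignment : Set
Assignment = ℕ → Bool

SatClause : ∀ {n} → Assignment → Clause n → Set
SatClause u (Π , E) =
  (Σ _ λ p → p ∈ Π × u (toℕ p) ≡ false) ⊎ (Σ _ λ q → E ≡ just q × u (toℕ q) ≡ true)

SatNeg : ∀ {n} → Assignment → List (Fin n) → Set
SatNeg u Σ' = Σ _ λ p → p ∈ Σ' × u (toℕ p) ≡ false

Coherent : ∀ {L : Lang} → System L → Set
Coherent {L} G =
  ∀ (c : Lang.Conn L) (l : LeftRule (Lang.arity L c)) (r : RightRule (Lang.arity L c)) →
  System.Left G c l → System.Right G c r →
  ¬ (Σ Assignment λ u →
       (∀ cl → cl ∈ LeftRule.S₁ l → SatClause u cl) ×
       (∀ Σ' → Σ' ∈ LeftRule.S₂ l → SatNeg u Σ') ×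
       (∀ cl → cl ∈ r → SatClause u cl))

module _ {L : Lang} where

  FSet : Set₁
  FSet = Form {L} → Set

  _⊆ᴱ_ : Maybe (Form {L}) → Maybe (Form {L}) → Set
  E ⊆ᴱ E' = ∀ x → E ≡ just x → E' ≡ just x

  _∪｛_｝ : FSet → Form {L} → FSet
  (T ∪｛ ψ ｝) x = T x ⊎ x ≡ ψ

  image : Subst {L} → FSet → FSet
  image σ T x = Σ (Form {L}) λ φ → T φ × x ≡ sub σ φ

  setOf : List (Form {L}) → FSet
  setOf Γ x = x ∈ Γ

  p₁ p₂ : Form {L}
  p₁ = atom 0
  p₂ = atom 1

  record IsExtendedTarskian (_⊢_ : FSet → Maybe (Form {L}) → Set) : Set₁ where
    field
      reflexivity  : ∀ (T : FSet) φ → T φ → T ⊢ just φ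
      monotonicity : ∀ (T T' : FSet) E E' → T ⊢ E →
                     (∀ x → T x → T' x) → E ⊆ᴱ E' → T' ⊢ E'
      transitivity : ∀ (T : FSet) ψ E → T ⊢ just ψ → (T ∪｛ ψ ｝) ⊢ E → T ⊢ E

  record IsExtendedLogic (_⊢_ : FSet → Maybe (Form {L}) → Set) : Set₁ where
    field
      tarskian   : IsExtendedTarskian _⊢_
      structural : ∀ (T : FSet) E (σ : Subst {L}) → T ⊢ E → image σ T ⊢ subE σ E
      finitary   : ∀ (T : FSet) E → T ⊢ E →
                   Σ (List (Form {L})) λ Γ → (∀ x → x ∈ Γ → T x) × (setOf Γ ⊢ E)
      consistent : ¬ ((λ x → x ≡ p₁) ⊢ just p₂)

-- The Tarskian laws and finitarity are closure properties of derivability, and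
-- structurality holds because every rule is schematic, so substituting into a
-- derivation gives a derivation.  Consistency is semantic: make p₁ the only true
-- atom and call σ(⋄(p₁,…,pₙ)) true when the premises of some right rule for ⋄
-- hold of σ(p₁),…,σ(pₙ).  Right rules are then sound by construction.  A left
-- rule is sound by coherence: were its principal formula true via a right rule r
-- while its premises hold, the truth values of σ(p₁),…,σ(pₙ) would be an
-- assignment satisfying the premises of both rules.  Everything is read under
-- double negation, where those finitely many truth values can be decided.

module Submission where

open import Defs
open import Data.Nat using (ℕ; zero; suc)
open import Data.Fin using (Fin; zero; suc; toℕ)
open import Data.Bool using (Bool; false)
open import Data.Vec using (Vec; []; _∷_; tabulate)
open import Data.List using (List; []; _∷_; _++_; map)
open import Data.List.Properties using (map-++; map-∘)
open import Data.List.Relation.Unary.Any using (here; there)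
open import Data.List.Relation.Unary.All using (All; []; _∷_; all?)
import Data.List.Relation.Unary.All as All
open import Data.List.Relation.Unary.All.Properties using (++⁺; ++⁻; map⁺; anti-mono; ¬All⇒Any¬)
open import Data.List.Membership.Propositional using (_∈_; find)
open import Data.List.Membership.Propositional.Properties using (∈-map⁻; ∈-++⁻)
import Data.List.Relation.Binary.Subset.Propositional.Properties as Subset
open import Data.Maybe using (Maybe; just; nothing) renaming (map to mapMaybe)
import Data.Maybe.Properties as Maybe
import Data.Maybe.Relation.Unary.Any as Maybe
open import Data.Product using (Σ; _×_; _,_)
open import Data.Sum using (_⊎_; inj₁; inj₂; [_,_]′) renaming (map₁ to ⊎-map₁)
open import Data.Empty using (⊥; ⊥-elim)
open import Relation.Nullary using (¬_; Dec; yes; no; _because_; Reflects; ofⁿ; ofʸ)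
open import Relation.Nullary.Decidable using (¬¬-excluded-middle)
open import Relation.Nullary.Negation using (¬¬-map)
open import Relation.Nullary.Reflects using (det)
open import Relation.Binary.PropositionalEquality using (_≡_; refl; sym; trans; cong; cong₂; subst; subst₂)
open import Function using (_∘_; id)

private variable
  n : ℕ
  L : Lang

Represents : Assignment → (Fin n → Set) → Set
Represents u Q = ∀ i → Reflects (Q i) (u (toℕ i))

¬¬-represented : (Q : Fin n → Set) → ¬ ¬ (Σ Assignment λ u → Represents u Q)
¬¬-represented {zero}  Q k = k ((λ _ → false) , λ ())
¬¬-represented {suc n} Q k =
  ¬¬-excluded-middle λ (b because Q₀) →
  ¬¬-represented (Q ∘ suc) λ (u , ρ) →
  k (extend b u , λ { zero → Q₀ ; (suc i) → ρ i })
  where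
  extend : Bool → Assignment → Assignment
  extend b u zero    = b
  extend b u (suc m) = u m

Holds : (Fin n → Set) → Clause n → Set
Holds Q (Π , E) = All Q Π → ¬ ¬ Maybe.Any Q E

module _ (u : Assignment) {Q : Fin n → Set} (ρ : Represents u Q) where

  private
    decide : ∀ i → Dec (Q i)
    decide i = u (toℕ i) because ρ i

  holds⇒sat : ∀ cl → Holds Q cl → SatClause u cl
  holds⇒sat (Π , E) holds with all? decide Π
  ... | no ¬all =
    let p , p∈Π , ¬Qp = find (¬All⇒Any¬ decide Π ¬all)
    in inj₁ (p , p∈Π , det (ρ p) (ofⁿ ¬Qp))
  holds⇒sat (Π , nothing) holds | yes all = ⊥-elim (holds all λ ())
  holds⇒sat (Π , just j)  holds | yes all with decide j
  ... | yes Qj = inj₂ (j , refl , det (ρ j) (ofʸ Qj))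
  ... | no ¬Qj = ⊥-elim (holds all λ { (Maybe.just Qj) → ¬Qj Qj })

satClause⇒satNeg : ∀ u (Σ' : List (Fin n)) → SatClause u (Σ' , nothing) → SatNeg u Σ'
satClause⇒satNeg u Σ' (inj₁ s)            = s
satClause⇒satNeg u Σ' (inj₂ (_ , () , _))

module _ {G : System L} (coh : Coherent G) {c : Lang.Conn L}
         {l : LeftRule (Lang.arity L c)} {r : RightRule (Lang.arity L c)}
         (Gl : System.Left G c l) (Gr : System.Right G c r) where

  coherent⇒¬Holds : (Q : Fin (Lang.arity L c) → Set) →
    (∀ cl → cl ∈ LeftRule.S₁ l → Holds Q cl) →
    (∀ Σ' → Σ' ∈ LeftRule.S₂ l → Holds Q (Σ' , nothing)) →
    (∀ cl → cl ∈ r → Holds Q cl) → ⊥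
  coherent⇒¬Holds Q h₁ h₂ h₃ = ¬¬-represented Q λ (u , ρ) →
    coh c l r Gl Gr
      ( u
      , (λ cl m → holds⇒sat u ρ cl (h₁ cl m))
      , (λ Σ' m → satClause⇒satNeg u Σ' (holds⇒sat u ρ (Σ' , nothing) (h₂ Σ' m)))
      , (λ cl m → holds⇒sat u ρ cl (h₃ cl m)))

mutual
  sub-∘ : (σ τ : Subst {L}) (φ : Form {L}) → sub σ (sub τ φ) ≡ sub (sub σ ∘ τ) φ
  sub-∘ σ τ (atom k)   = refl
  sub-∘ σ τ (app c φs) = cong (app c) (subV-∘ σ τ φs)

  subV-∘ : (σ τ : Subst {L}) (φs : Vec (Form {L}) n) → subV σ (subV τ φs) ≡ subV (sub σ ∘ τ) φs
  subV-∘ σ τ []       = refl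
  subV-∘ σ τ (φ ∷ φs) = cong₂ _∷_ (sub-∘ σ τ φ) (subV-∘ σ τ φs)

module _ {G : System L} where

  private
    _⊢_ = _⇒_ G

    sub-premise : (σ τ : Subst {L}) (Γ : List (Form {L})) (Π : List (Fin n)) →
      map (sub σ) (Γ ++ map (sub τ ∘ pa) Π) ≡ map (sub σ) Γ ++ map (sub (sub σ ∘ τ) ∘ pa) Π
    sub-premise σ τ Γ Π =
      trans (map-++ (sub σ) Γ _) (cong (map (sub σ) Γ ++_) (sym (map-∘ Π)))

  sub-⇒ : ∀ (σ : Subst {L}) {Γ E} → Γ ⊢ E → map (sub σ) Γ ⊢ subE σ E
  sub-⇒ σ (axiom φ)            = axiom (sub σ φ)
  sub-⇒ σ (weakL d Γ⊆Γ')       = weakL (sub-⇒ σ d) (λ _ → Subset.map⁺ (sub σ) (Γ⊆Γ' _))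
  sub-⇒ σ (weakR ψ d)          = weakR (sub σ ψ) (sub-⇒ σ d)
  sub-⇒ σ (cut {Γ} {Δ} φ d₁ d₂) =
    subst (_⊢ _) (sym (map-++ (sub σ) Γ Δ)) (cut (sub σ φ) (sub-⇒ σ d₁) (sub-⇒ σ d₂))
  sub-⇒ σ (right {Γ} c r Gr τ prems) =
    subst (λ φ → map (sub σ) Γ ⊢ just φ) (sym (sub-∘ σ τ (generic c)))
      (right c r Gr (sub σ ∘ τ) λ Π E m →
        subst₂ _⊢_ (sub-premise σ τ Γ Π) (sym (Maybe.map-∘ E)) (sub-⇒ σ (prems Π E m)))
  sub-⇒ σ (left {Γ} {E} c l Gl τ prems₁ prems₂) =
    subst (λ φ → (φ ∷ map (sub σ) Γ) ⊢ subE σ E) (sym (sub-∘ σ τ (generic c)))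
      (left c l Gl (sub σ ∘ τ)
        (λ Π E' m → subst₂ _⊢_ (sub-premise σ τ Γ Π) (sym (Maybe.map-∘ E')) (sub-⇒ σ (prems₁ Π E' m)))
        (λ Σ' m → subst (_⊢ _) (sub-premise σ τ Γ Σ') (sub-⇒ σ (prems₂ Σ' m))))

module Semantics (G : System L) (ν : ℕ → Set) where
  open Lang L
  open System G

  private
    _⊢_ = _⇒_ G

  mutual
    ⟦_⟧ : Form {L} → Set
    ⟦ atom k ⟧   = ν k
    ⟦ app c φs ⟧ = Σ (RightRule (arity c)) λ r → Right c r × (∀ cl → cl ∈ r → Holds ⟦ φs ⟧ⱽ cl)

    ⟦_⟧ⱽ : Vec (Form {L}) n → Fin n → Set
    ⟦ φ ∷ φs ⟧ⱽ zero    = ⟦ φ ⟧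
    ⟦ φ ∷ φs ⟧ⱽ (suc i) = ⟦ φs ⟧ⱽ i

  ⟦⟧ⱽ-subV-tabulate : (σ : Subst {L}) (f : Fin n → Form {L}) (i : Fin n) →
    ⟦ subV σ (tabulate f) ⟧ⱽ i ≡ ⟦ sub σ (f i) ⟧
  ⟦⟧ⱽ-subV-tabulate σ f zero    = refl
  ⟦⟧ⱽ-subV-tabulate σ f (suc i) = ⟦⟧ⱽ-subV-tabulate σ (f ∘ suc) i

  module _ (σ : Subst {L}) where

    premise-context : ∀ {Γ} {Π : List (Fin n)} →
      All ⟦_⟧ Γ → All ⟦ subV σ (tabulate pa) ⟧ⱽ Π → All ⟦_⟧ (Γ ++ map (sub σ ∘ pa) Π)
    premise-context hΓ hΠ =
      ++⁺ hΓ (map⁺ (All.map (λ {i} → subst id (⟦⟧ⱽ-subV-tabulate σ pa i)) hΠ))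

    premise-succedent : (E : Maybe (Fin n)) →
      Maybe.Any ⟦_⟧ (mapMaybe (sub σ ∘ pa) E) → Maybe.Any ⟦ subV σ (tabulate pa) ⟧ⱽ E
    premise-succedent (just i) (Maybe.just t) =
      Maybe.just (subst id (sym (⟦⟧ⱽ-subV-tabulate σ pa i)) t)

  module _ (coh : Coherent G) where

    mutual
      sound : ∀ {Γ E} → Γ ⊢ E → All ⟦_⟧ Γ → ¬ ¬ Maybe.Any ⟦_⟧ E
      sound (axiom φ)         (t ∷ []) k = k (Maybe.just t)
      sound (weakL d Γ⊆Γ')    h          = sound d (anti-mono (Γ⊆Γ' _) h)
      sound (weakR ψ d)       h          = ¬¬-map (λ ()) (sound d h)
      sound (cut {Γ} φ d₁ d₂) h          k =
        let hΓ , hΔ = ++⁻ Γ h in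
        sound d₁ hΓ λ { (Maybe.just tφ) → sound d₂ (tφ ∷ hΔ) k }
      sound (right c r Gr σ prems) hΓ k =
        k (Maybe.just (r , Gr , λ (Π , E) m → sound-premise σ hΓ (prems Π E m)))
      sound (left c l Gl σ prems₁ prems₂) ((r , Gr , hr) ∷ hΓ) k =
        coherent⇒¬Holds coh Gl Gr _
          (λ (Π , E) m → sound-premise σ hΓ (prems₁ Π E m))
          -- the premises Γ, σ(Σ) ⇒ E share the conclusion E, which k refutes
          (λ Σ' m hΣ _ → sound (prems₂ Σ' m) (premise-context σ hΓ hΣ) k)
          hr

      sound-premise : ∀ σ {Γ} {Π : List (Fin n)} {E} →
        All ⟦_⟧ Γ → (Γ ++ map (sub σ ∘ pa) Π) ⊢ mapMaybe (sub σ ∘ pa) E →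
        Holds ⟦ subV σ (tabulate pa) ⟧ⱽ (Π , E)
      sound-premise σ {E = E} hΓ d hΠ =
        ¬¬-map (premise-succedent σ E) (sound d (premise-context σ hΓ hΠ))

module _ {G : System L} where

  private
    _⊢_ = _⇒_ G

  p₁⊬p₂ : Coherent G → ¬ (_⊢G_ G (_≡ p₁) (just p₂))
  p₁⊬p₂ coh (Γ , Γ⊆p₁ , d) =
    sound coh d (All.tabulate λ m → subst ⟦_⟧ (sym (Γ⊆p₁ _ m)) refl) λ { (Maybe.just ()) }
    where open Semantics G (_≡ 0)

  ⇒-monoʳ : ∀ {Γ E E'} → E ⊆ᴱ E' → Γ ⊢ E → Γ ⊢ E'
  ⇒-monoʳ {Γ} {E = just φ}            E⊆E' d = subst (Γ ⊢_) (sym (E⊆E' φ refl)) d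
  ⇒-monoʳ {E = nothing} {E' = just ψ}  _    d = weakR ψ d
  ⇒-monoʳ {E = nothing} {E' = nothing} _    d = d

  split-∪ : ∀ {T : FSet} {ψ} (Γ : List (Form {L})) → (∀ x → x ∈ Γ → (T ∪｛ ψ ｝) x) →
    Σ (List (Form {L})) λ Δ → (∀ x → x ∈ Δ → T x) × (∀ x → x ∈ Γ → x ∈ Δ ⊎ x ≡ ψ)
  split-∪ []      _       = [] , (λ _ ()) , (λ _ ())
  split-∪ (y ∷ Γ) Γ⊆T∪ψ with split-∪ Γ (λ x → Γ⊆T∪ψ x ∘ there) | Γ⊆T∪ψ y (here refl)
  ... | Δ , Δ⊆T , Γ⊆Δ∪ψ | inj₁ Ty =
    y ∷ Δ , (λ { _ (here refl) → Ty ; x (there m) → Δ⊆T x m })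
          , (λ { _ (here refl) → inj₁ (here refl) ; x (there m) → ⊎-map₁ there (Γ⊆Δ∪ψ x m) })
  ... | Δ , Δ⊆T , Γ⊆Δ∪ψ | inj₂ refl =
    Δ , Δ⊆T , (λ { _ (here refl) → inj₂ refl ; x (there m) → Γ⊆Δ∪ψ x m })

  ⊢G-structural : ∀ (T : FSet) E (σ : Subst {L}) → _⊢G_ G T E → _⊢G_ G (image σ T) (subE σ E)
  ⊢G-structural T E σ (Γ , Γ⊆T , d) =
    map (sub σ) Γ , (λ x m → let φ , φ∈Γ , x≡σφ = ∈-map⁻ (sub σ) m in φ , Γ⊆T φ φ∈Γ , x≡σφ)
                  , sub-⇒ σ d

  ⊢G-isExtendedTarskian : IsExtendedTarskian (_⊢G_ G)
  ⊢G-isExtendedTarskian = record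
    { reflexivity  = λ T φ Tφ → φ ∷ [] , (λ { _ (here refl) → Tφ }) , axiom φ
    ; monotonicity = λ { T T' E E' (Γ , Γ⊆T , d) T⊆T' E⊆E' →
        Γ , (λ x → T⊆T' x ∘ Γ⊆T x) , ⇒-monoʳ E⊆E' d }
    ; transitivity = λ { T ψ E (Γ₁ , Γ₁⊆T , d₁) (Γ₂ , Γ₂⊆T∪ψ , d₂) →
        let Δ , Δ⊆T , Γ₂⊆Δ∪ψ = split-∪ Γ₂ Γ₂⊆T∪ψ in
        Γ₁ ++ Δ , (λ x → [ Γ₁⊆T x , Δ⊆T x ]′ ∘ ∈-++⁻ Γ₁)
                , cut ψ d₁ (weakL d₂ λ x → [ there , here ]′ ∘ Γ₂⊆Δ∪ψ x) }
    }

corollary6p11 : (L : Lang) (G : System L) → Coherent G → IsExtendedLogic (_⊢G_ G)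
corollary6p11 L G coh = record
  { tarskian   = ⊢G-isExtendedTarskian
  ; structural = ⊢G-structural
  ; finitary   = λ { T E (Γ , Γ⊆T , d) → Γ , Γ⊆T , Γ , (λ _ m → m) , d }
  ; consistent = p₁⊬p₂ coh
  }
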